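{- Let $t_1,t'_1,t_2,t'_2$ be bracketings of size $n$ and $T_1,T'_1,T_2,T'_2$ the corresponding binary trees. Then the following are equivalent: (i) for every linear quasigroup $\mathbf{A}$, if $\mathbf{A}$ satisfies $t_1\approx t'_1$ then $\mathbf{A}$ satisfies $t_2\approx t'_2$; (ii) $\Lambda_{T_2,T'_2}\subseteq\Lambda_{T_1,T'_1}$.
   Context: A binary tree is a finite rooted plane tree in which every internal vertex has exactly two ordered children (left and right); leaves of a tree with $n$ leaves are numbered $1,\dots,n$ from left to right. The left depth $\mathrm{ld}_T(i)$ (right depth $\mathrm{rd}_T(i)$) of a leaf $i$ is the number of steps to a left (right) child on the path from the root to $i$. A bracketing of size $n$ is a fully parenthesised product of $x_1,\dots,x_n$ in this order; its corresponding tree is given by $\tau(x_i)=$ one-vertex tree, $\tau((s_1s_2))=$ tree whose root has left subtree $\tau(s_1)$ and right subtree $\tau(s_2)$. For trees $T,T'$ with $n$ leaves, $\Lambda_{T,T'}$ is the subgroup of $\mathbb{Z}\times\mathbb{Z}$ generated by $\{(\mathrm{ld}_T(i)-\mathrm{ld}_{T'}(i),\mathrm{rd}_T(i)-\mathrm{rd}_{T'}(i)):i=1,\dots,n\}$. A linear quasigroup is a groupoid $(A,\circ)$ with $x\circ y=\varphi_0(x)+\varphi_1(y)$ for some (not necessarily abelian) group $(A,+)$ and automorphisms $\varphi_0,\varphi_1$ of it; it satisfies $t\approx t'$ if the two terms induce the same term operation. -}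

module Defs where

open import Level using (0ℓ)
open import Data.Nat using (ℕ; zero; suc) renaming (_+_ to _+ℕ_)
open import Data.Fin using (Fin; zero; splitAt; _↑ˡ_; _↑ʳ_)
open import Data.Sum using (inj₁; inj₂)
open import Data.Integer using (ℤ; +_; _-_) renaming (_+_ to _+ℤ_; -_ to -ℤ_)
open import Data.Product using (_×_; _,_)
open import Algebra.Bundles using (Group)
open import Algebra.Morphism.Structures using (module GroupMorphisms)

-- Binary trees with n leaves (leaves implicitly numbered 0..n-1 left to right).
data BinTree : ℕ → Set where
  leaf : BinTree 1
  node : ∀ {m k} → BinTree m → BinTree k → BinTree (m +ℕ k)

-- A bracketing of size n: fully parenthesised product of x_1,...,x_n in
-- this order.  x is the single variable, (s₁ · s₂) the product.
data Bracketing : ℕ → Set where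
  x   : Bracketing 1
  _·_ : ∀ {m k} → Bracketing m → Bracketing k → Bracketing (m +ℕ k)

τ : ∀ {n} → Bracketing n → BinTree n
τ x         = leaf
τ (s₁ · s₂) = node (τ s₁) (τ s₂)

ld : ∀ {n} → BinTree n → Fin n → ℕ
ld leaf zero = 0
ld (node {m} l r) i with splitAt m i
... | inj₁ j = suc (ld l j)
... | inj₂ j = ld r j

rd : ∀ {n} → BinTree n → Fin n → ℕ
rd leaf zero = 0
rd (node {m} l r) i with splitAt m i
... | inj₁ j = rd l j
... | inj₂ j = suc (rd r j)

genΛ : ∀ {n} → BinTree n → BinTree n → Fin n → ℤ × ℤ
genΛ T T' i = ((+ ld T i) - (+ ld T' i)) , ((+ rd T i) - (+ rd T' i))

data Λ {n} (T T' : BinTree n) : ℤ × ℤ → Set where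
  gen : ∀ i → Λ T T' (genΛ T T' i)
  zro : Λ T T' (+ 0 , + 0)
  add : ∀ {a b c d} → Λ T T' (a , b) → Λ T T' (c , d) → Λ T T' (a +ℤ c , b +ℤ d)
  neg : ∀ {a b} → Λ T T' (a , b) → Λ T T' (-ℤ a , -ℤ b)

_⊆Λ_ : (ℤ × ℤ → Set) → (ℤ × ℤ → Set) → Set
P ⊆Λ Q = ∀ v → P v → Q v

IsAutomorphism : (G : Group 0ℓ 0ℓ) → (Group.Carrier G → Group.Carrier G) → Set
IsAutomorphism G f = GroupMorphisms.IsGroupIsomorphism (Group.rawGroup G) (Group.rawGroup G) f

record LinearQuasigroup : Set₁ where
  field
    G     : Group 0ℓ 0ℓ
    φ₀ φ₁ : Group.Carrier G → Group.Carrier G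
    φ₀-aut : IsAutomorphism G φ₀
    φ₁-aut : IsAutomorphism G φ₁

  Carrier : Set
  Carrier = Group.Carrier G

  _∘_ : Carrier → Carrier → Carrier
  a ∘ b = Group._∙_ G (φ₀ a) (φ₁ b)

evalIn : (A : LinearQuasigroup) → ∀ {n} → Bracketing n →
         (Fin n → LinearQuasigroup.Carrier A) → LinearQuasigroup.Carrier A
evalIn A x ρ = ρ zero
evalIn A (_·_ {m} {k} s₁ s₂) ρ =
  LinearQuasigroup._∘_ A (evalIn A s₁ (λ i → ρ (i ↑ˡ k)))
                         (evalIn A s₂ (λ i → ρ (m ↑ʳ i)))

Satisfies : LinearQuasigroup → ∀ {n} → Bracketing n → Bracketing n → Set
Satisfies A t t' = ∀ ρ → Group._≈_ (LinearQuasigroup.G A) (evalIn A t ρ) (evalIn A t' ρ)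

-- In a linear quasigroup the term operation of a bracketing of size n is
-- (x₁, …, xₙ) ↦ w₁(x₁) + ⋯ + wₙ(xₙ), where wᵢ composes φ₀ (left steps) and φ₁ (right
-- steps) along the path to leaf i; so t ≈ t' holds iff both trees give the same wᵢ at
-- every leaf.  Consecutive leaves have paths u01ᵏ and u10ᵐ, and if the trees agree at
-- leaf i they agree at leaf i+1 iff φ₀ φ₁^β φ₀⁻¹ = φ₁ φ₀^(-α) φ₁⁻¹ where (α, β) is the
-- difference of the corresponding generators of Λ.  These balanced pairs form a
-- subgroup of ℤ², so t ≈ t' holds iff Λ_{T,T'} consists of balanced pairs, which
-- gives (ii) ⇒ (i).  Conversely the maps ℤ²/Λ → ℤ²/Λ, with φ₀ and φ₁ the shifts by
-- (1,0) and (0,1), form a linear quasigroup whose balanced pairs are exactly Λ.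

module Submission where

open import Defs
open import Data.Nat using (ℕ)
open import Function.Bundles using (_⇔_)

open import Level using (Level; 0ℓ; _⊔_)
open import Data.Nat using (zero; suc; _≤_; s≤s) renaming (_+_ to _+ℕ_)
import Data.Nat.Properties as ℕ
open import Data.Integer using (ℤ; +_; -[1+_]; +0; 1ℤ; -1ℤ; _+_; _-_; -_; _*_)
import Data.Integer.Properties as ℤ
open import Data.Integer.Tactic.RingSolver using (solve-∀)
open import Data.Fin using (Fin; zero; suc; toℕ; splitAt; _↑ˡ_; _↑ʳ_; inject₁)
open import Data.Fin.Properties
  using (splitAt-↑ˡ; splitAt-↑ʳ; splitAt⁻¹-↑ˡ; splitAt⁻¹-↑ʳ; toℕ-↑ˡ; toℕ-↑ʳ; toℕ<n; toℕ-inject₁; suc-injective)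
open import Data.Fin.Induction using (<-weakInduction)
open import Data.Bool using (Bool; false; true)
open import Data.List using (List; []; _∷_; _++_; replicate)
open import Data.Product using (∃; _×_; _,_; proj₁; proj₂)
open import Data.Sum using (inj₁; inj₂; [_,_]′)
open import Data.Vec.Functional using (Vector; updateAt)
open import Data.Vec.Functional.Properties using (updateAt-updates; updateAt-minimal)
open import Algebra.Bundles using (Monoid; Group)
open import Algebra.Morphism.Structures using (module GroupMorphisms)
open import Function.Base using (_∘_; const)
open import Function.Bundles using (Inverse; mk⇔; Equivalence)
open import Function.Properties.Bijection using (Bijection⇒Inverse)
open import Function.Properties.Equivalence using (⇔-setoid)
import Function.Construct.Composition as Composition
import Function.Construct.Identity as Identity
import Function.Construct.Symmetry as Symmetry
open import Relation.Binary.Bundles using (Setoid)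
open import Relation.Binary.PropositionalEquality as ≡ using (_≡_; _≢_)
open import Relation.Nullary using (contradiction)

private
  variable
    c ℓ : Level

module IntegerPowers (G : Group c ℓ) where

  open Group G hiding (_-_)
  import Algebra.Definitions.RawMonoid rawMonoid as Multiple
  open import Algebra.Properties.Group G using (\\-leftDividesˡ; \\-leftDividesʳ; inverseˡ-unique)
  open import Relation.Binary.Reasoning.Setoid setoid

  infixr 8 _^_

  _^_ : Carrier → ℤ → Carrier
  g ^ + n      = n Multiple.× g
  g ^ -[1+ n ] = suc n Multiple.× (g ⁻¹)

  ^-congʳ : ∀ g {i j} → i ≡ j → g ^ i ≈ g ^ j
  ^-congʳ g ≡.refl = refl

  ^-suc : ∀ g i → g ^ (1ℤ + i) ≈ g ∙ g ^ i
  ^-suc g (+ n)        = refl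
  ^-suc g -[1+ zero ]  = sym (trans (∙-congˡ (identityʳ (g ⁻¹))) (inverseʳ g))
  ^-suc g -[1+ suc n ] = sym (\\-leftDividesˡ g _)

  ^-pred : ∀ g i → g ^ (-1ℤ + i) ≈ g ⁻¹ ∙ g ^ i
  ^-pred g +0        = refl
  ^-pred g (+ suc n) = sym (\\-leftDividesʳ g _)
  ^-pred g -[1+ n ]  = refl

  ^-+ : ∀ g i j → g ^ (i + j) ≈ g ^ i ∙ g ^ j
  ^-+ g +0 j = trans (^-congʳ g (ℤ.+-identityˡ j)) (sym (identityˡ _))
  ^-+ g (+ suc n) j = begin
    g ^ (1ℤ + + n + j)     ≈⟨ ^-congʳ g (ℤ.+-assoc 1ℤ (+ n) j) ⟩
    g ^ (1ℤ + (+ n + j))   ≈⟨ ^-suc g (+ n + j) ⟩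
    g ∙ g ^ (+ n + j)      ≈⟨ ∙-congˡ (^-+ g (+ n) j) ⟩
    g ∙ (g ^ + n ∙ g ^ j)  ≈⟨ assoc g _ _ ⟨
    g ^ + suc n ∙ g ^ j    ∎
  ^-+ g -[1+ zero ] j = trans (^-pred g j) (∙-congʳ (sym (identityʳ (g ⁻¹))))
  ^-+ g -[1+ suc n ] j = begin
    g ^ (-1ℤ + -[1+ n ] + j)       ≈⟨ ^-congʳ g (ℤ.+-assoc -1ℤ -[1+ n ] j) ⟩
    g ^ (-1ℤ + (-[1+ n ] + j))     ≈⟨ ^-pred g (-[1+ n ] + j) ⟩
    g ⁻¹ ∙ g ^ (-[1+ n ] + j)      ≈⟨ ∙-congˡ (^-+ g -[1+ n ] j) ⟩
    g ⁻¹ ∙ (g ^ -[1+ n ] ∙ g ^ j)  ≈⟨ assoc (g ⁻¹) _ _ ⟨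
    g ^ -[1+ suc n ] ∙ g ^ j       ∎

  ^-neg : ∀ g i → g ^ (- i) ≈ (g ^ i) ⁻¹
  ^-neg g i = inverseˡ-unique _ _ (begin
    g ^ (- i) ∙ g ^ i  ≈⟨ ^-+ g (- i) i ⟨
    g ^ (- i + i)      ≈⟨ ^-congʳ g (ℤ.+-inverseˡ i) ⟩
    ε                  ∎)

  ^-// : ∀ g i j → g ^ j // g ^ i ≈ g ^ (j - i)
  ^-// g i j = sym (trans (^-+ g j (- i)) (∙-congˡ (^-neg g i)))

module Conjugation (G : Group c ℓ) where

  open Group G hiding (_-_)
  open import Algebra.Properties.Group G using (\\-leftDividesʳ; inverseˡ-unique; ⁻¹-anti-homo-∙)
  open import Relation.Binary.Reasoning.Setoid setoid

  conj : Carrier → Carrier → Carrier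
  conj g y = g ∙ y ∙ g ⁻¹

  conj-cong : ∀ g {y z} → y ≈ z → conj g y ≈ conj g z
  conj-cong g y≈z = ∙-congʳ (∙-congˡ y≈z)

  conj-ε : ∀ g → conj g ε ≈ ε
  conj-ε g = trans (∙-congʳ (identityʳ g)) (inverseʳ g)

  conj-∙ : ∀ g y z → conj g (y ∙ z) ≈ conj g y ∙ conj g z
  conj-∙ g y z = sym (begin
    g ∙ y ∙ g ⁻¹ ∙ (g ∙ z ∙ g ⁻¹)    ≈⟨ ∙-congˡ (assoc g z (g ⁻¹)) ⟩
    g ∙ y ∙ g ⁻¹ ∙ (g ∙ (z ∙ g ⁻¹))  ≈⟨ assoc (g ∙ y) (g ⁻¹) _ ⟩
    g ∙ y ∙ (g ⁻¹ ∙ (g ∙ (z ∙ g ⁻¹))) ≈⟨ ∙-congˡ (\\-leftDividesʳ g _) ⟩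
    g ∙ y ∙ (z ∙ g ⁻¹)               ≈⟨ assoc (g ∙ y) z (g ⁻¹) ⟨
    g ∙ y ∙ z ∙ g ⁻¹                 ≈⟨ ∙-congʳ (assoc g y z) ⟩
    g ∙ (y ∙ z) ∙ g ⁻¹               ∎)

  conj-⁻¹ : ∀ g y → conj g (y ⁻¹) ≈ (conj g y) ⁻¹
  conj-⁻¹ g y = inverseˡ-unique _ _ (begin
    conj g (y ⁻¹) ∙ conj g y  ≈⟨ conj-∙ g (y ⁻¹) y ⟨
    conj g (y ⁻¹ ∙ y)         ≈⟨ conj-cong g (inverseˡ y) ⟩
    conj g ε                  ≈⟨ conj-ε g ⟩
    ε                         ∎)

  //-conj : ∀ g y z → g ∙ y // g ∙ z ≈ conj g (y // z)
  //-conj g y z = begin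
    g ∙ y ∙ (g ∙ z) ⁻¹      ≈⟨ ∙-congˡ (⁻¹-anti-homo-∙ g z) ⟩
    g ∙ y ∙ (z ⁻¹ ∙ g ⁻¹)   ≈⟨ assoc (g ∙ y) (z ⁻¹) (g ⁻¹) ⟨
    g ∙ y ∙ z ⁻¹ ∙ g ⁻¹     ≈⟨ ∙-congʳ (assoc g y (z ⁻¹)) ⟩
    g ∙ (y // z) ∙ g ⁻¹     ∎

module GroupEquations (G : Group c ℓ) where

  open Group G hiding (_-_)
  open import Algebra.Properties.Group G
    using (\\-leftDividesˡ; \\-leftDividesʳ; //-rightDividesˡ; quasigroup)
  open import Algebra.Properties.Quasigroup quasigroup using (x≈z//y)
  open import Relation.Binary.Reasoning.Setoid setoid

  ≈-resp-⇔ : ∀ {y₁ y₂ z₁ z₂} → y₁ ≈ y₂ → z₁ ≈ z₂ → (y₁ ≈ z₁ ⇔ y₂ ≈ z₂)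
  ≈-resp-⇔ y₁≈y₂ z₁≈z₂ =
    mk⇔ (λ eq → trans (sym y₁≈y₂) (trans eq z₁≈z₂)) (λ eq → trans y₁≈y₂ (trans eq (sym z₁≈z₂)))

  ∙≈∙⇔\\≈// : ∀ y₁ y₂ z₁ z₂ → (y₁ ∙ y₂ ≈ z₁ ∙ z₂) ⇔ (z₁ \\ y₁ ≈ z₂ // y₂)
  ∙≈∙⇔\\≈// y₁ y₂ z₁ z₂ = mk⇔
    (λ eq → x≈z//y (z₁ \\ y₁) y₂ z₂ (begin
      z₁ ⁻¹ ∙ y₁ ∙ y₂     ≈⟨ assoc (z₁ ⁻¹) y₁ y₂ ⟩
      z₁ ⁻¹ ∙ (y₁ ∙ y₂)   ≈⟨ ∙-congˡ eq ⟩
      z₁ ⁻¹ ∙ (z₁ ∙ z₂)   ≈⟨ \\-leftDividesʳ z₁ z₂ ⟩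
      z₂                  ∎))
    (λ eq → begin
      y₁ ∙ y₂                ≈⟨ ∙-congʳ (\\-leftDividesˡ z₁ y₁) ⟨
      z₁ ∙ (z₁ \\ y₁) ∙ y₂   ≈⟨ assoc z₁ (z₁ \\ y₁) y₂ ⟩
      z₁ ∙ ((z₁ \\ y₁) ∙ y₂) ≈⟨ ∙-congˡ (∙-congʳ eq) ⟩
      z₁ ∙ ((z₂ // y₂) ∙ y₂) ≈⟨ ∙-congˡ (//-rightDividesˡ y₂ z₂) ⟩
      z₁ ∙ z₂                ∎)

infixl 6 _⊕_

_⊕_ : ℤ × ℤ → ℤ × ℤ → ℤ × ℤ
v ⊕ w = proj₁ v + proj₁ w , proj₂ v + proj₂ w

⊖_ : ℤ × ℤ → ℤ × ℤ
⊖ v = - proj₁ v , - proj₂ v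

record IsSubgroup (P : ℤ × ℤ → Set ℓ) : Set ℓ where
  field
    0∈       : P (+0 , +0)
    ⊕-closed : ∀ {v w} → P v → P w → P (v ⊕ w)
    ⊖-closed : ∀ {v} → P v → P (⊖ v)

  ⊕-cancelˡ : ∀ {v w} → P v → P (v ⊕ w) ⇔ P w
  ⊕-cancelˡ {v} {w} v∈P = mk⇔
    (λ v⊕w∈P → ≡.subst P (≡.cong₂ _,_ (cancel (proj₁ v) (proj₁ w)) (cancel (proj₂ v) (proj₂ w)))
                          (⊕-closed (⊖-closed v∈P) v⊕w∈P))
    (⊕-closed v∈P)
    where
    cancel : ∀ i j → - i + (i + j) ≡ j
    cancel = solve-∀

Λ-isSubgroup : ∀ {n} (T T' : BinTree n) → IsSubgroup (Λ T T')
Λ-isSubgroup T T' = record { 0∈ = zro ; ⊕-closed = add ; ⊖-closed = neg }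

Λ-minimal : ∀ {n} {T T' : BinTree n} {P : ℤ × ℤ → Set ℓ} →
            IsSubgroup P → (∀ i → P (genΛ T T' i)) → ∀ v → Λ T T' v → P v
Λ-minimal P-sub gens∈P _ (gen i)   = gens∈P i
Λ-minimal P-sub gens∈P _ zro       = IsSubgroup.0∈ P-sub
Λ-minimal P-sub gens∈P _ (add u v) =
  IsSubgroup.⊕-closed P-sub (Λ-minimal P-sub gens∈P _ u) (Λ-minimal P-sub gens∈P _ v)
Λ-minimal P-sub gens∈P _ (neg u)   = IsSubgroup.⊖-closed P-sub (Λ-minimal P-sub gens∈P _ u)

-- Root-to-leaf paths of binary trees

-- false is a step to a left child, true a step to a right child.
path : ∀ {n} → BinTree n → Fin n → List Bool
path leaf           zero = []
path (node {m} L R) i    = [ (false ∷_) ∘ path L , (true ∷_) ∘ path R ]′ (splitAt m i)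

lefts rights : List Bool → ℕ
lefts []          = 0
lefts (false ∷ w) = suc (lefts w)
lefts (true  ∷ w) = lefts w
rights []          = 0
rights (false ∷ w) = rights w
rights (true  ∷ w) = suc (rights w)

lefts-++ : ∀ u v → lefts (u ++ v) ≡ lefts u +ℕ lefts v
lefts-++ []          v = ≡.refl
lefts-++ (false ∷ u) v = ≡.cong suc (lefts-++ u v)
lefts-++ (true  ∷ u) v = lefts-++ u v

rights-++ : ∀ u v → rights (u ++ v) ≡ rights u +ℕ rights v
rights-++ []          v = ≡.refl
rights-++ (false ∷ u) v = rights-++ u v
rights-++ (true  ∷ u) v = ≡.cong suc (rights-++ u v)

lefts-replicate-false : ∀ k → lefts (replicate k false) ≡ k
lefts-replicate-false zero    = ≡.refl
lefts-replicate-false (suc k) = ≡.cong suc (lefts-replicate-false k)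

lefts-replicate-true : ∀ k → lefts (replicate k true) ≡ 0
lefts-replicate-true zero    = ≡.refl
lefts-replicate-true (suc k) = lefts-replicate-true k

rights-replicate-false : ∀ k → rights (replicate k false) ≡ 0
rights-replicate-false zero    = ≡.refl
rights-replicate-false (suc k) = rights-replicate-false k

rights-replicate-true : ∀ k → rights (replicate k true) ≡ k
rights-replicate-true zero    = ≡.refl
rights-replicate-true (suc k) = ≡.cong suc (rights-replicate-true k)

ld≡lefts∘path : ∀ {n} (T : BinTree n) i → ld T i ≡ lefts (path T i)
ld≡lefts∘path leaf           zero = ≡.refl
ld≡lefts∘path (node {m} L R) i with splitAt m i
... | inj₁ j = ≡.cong suc (ld≡lefts∘path L j)
... | inj₂ j = ld≡lefts∘path R j

rd≡rights∘path : ∀ {n} (T : BinTree n) i → rd T i ≡ rights (path T i)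
rd≡rights∘path leaf           zero = ≡.refl
rd≡rights∘path (node {m} L R) i with splitAt m i
... | inj₁ j = rd≡rights∘path L j
... | inj₂ j = ≡.cong suc (rd≡rights∘path R j)

path-↑ˡ : ∀ {m k} (L : BinTree m) (R : BinTree k) i → path (node L R) (i ↑ˡ k) ≡ false ∷ path L i
path-↑ˡ {m} {k} L R i = ≡.cong [ (false ∷_) ∘ path L , (true ∷_) ∘ path R ]′ (splitAt-↑ˡ m i k)

path-↑ʳ : ∀ {m k} (L : BinTree m) (R : BinTree k) i → path (node L R) (m ↑ʳ i) ≡ true ∷ path R i
path-↑ʳ {m} {k} L R i = ≡.cong [ (false ∷_) ∘ path L , (true ∷_) ∘ path R ]′ (splitAt-↑ʳ m k i)

leaves-positive : ∀ {n} → BinTree n → 1 ≤ n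
leaves-positive leaf           = ℕ.≤-refl
leaves-positive (node {m} L R) = ℕ.≤-trans (leaves-positive L) (ℕ.m≤m+n m _)

splitAt-inj₁⇒toℕ≡ : ∀ {m k} {i : Fin (m +ℕ k)} {j} → splitAt m i ≡ inj₁ j → toℕ i ≡ toℕ j
splitAt-inj₁⇒toℕ≡ {k = k} {j = j} eq = ≡.trans (≡.cong toℕ (≡.sym (splitAt⁻¹-↑ˡ eq))) (toℕ-↑ˡ j k)

splitAt-inj₂⇒toℕ≡ : ∀ {m k} {i : Fin (m +ℕ k)} {j} → splitAt m i ≡ inj₂ j → toℕ i ≡ m +ℕ toℕ j
splitAt-inj₂⇒toℕ≡ {m} {j = j} eq = ≡.trans (≡.cong toℕ (≡.sym (splitAt⁻¹-↑ʳ eq))) (toℕ-↑ʳ m j)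

first-path : ∀ {n} (T : BinTree n) i → toℕ i ≡ 0 → ∃ λ l → path T i ≡ replicate l false
first-path leaf           zero _    = 0 , ≡.refl
first-path (node {m} L R) i    i≡0 with splitAt m i in eq
... | inj₁ j = let l , p = first-path L j (≡.trans (≡.sym (splitAt-inj₁⇒toℕ≡ eq)) i≡0)
               in suc l , ≡.cong (false ∷_) p
... | inj₂ j with () ← ℕ.≤-trans (leaves-positive L)
                         (ℕ.≤-reflexive (ℕ.m+n≡0⇒m≡0 m (≡.trans (≡.sym (splitAt-inj₂⇒toℕ≡ eq)) i≡0)))

last-path : ∀ {n} (T : BinTree n) i → suc (toℕ i) ≡ n → ∃ λ k → path T i ≡ replicate k true
last-path leaf           zero _      = 0 , ≡.refl
last-path (node {m} {k} L R) i i+1≡n with splitAt m i in eq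
... | inj₂ j = let r , p = last-path R j (ℕ.+-cancelˡ-≡ m _ _ (≡.trans (ℕ.+-suc m (toℕ j))
                                 (≡.trans (≡.cong suc (≡.sym (splitAt-inj₂⇒toℕ≡ eq))) i+1≡n)))
               in suc r , ≡.cong (true ∷_) p
... | inj₁ j = contradiction (ℕ.≤-trans (ℕ.+-monoʳ-≤ m (leaves-positive R)) m+k≤m) (ℕ.m+1+n≰m m)
  where
  m+k≤m : m +ℕ k ≤ m
  m+k≤m = ℕ.≤-trans (ℕ.≤-reflexive (≡.trans (≡.sym i+1≡n) (≡.cong suc (splitAt-inj₁⇒toℕ≡ eq)))) (toℕ<n j)

record Adjacent (p q : List Bool) : Set where
  field
    prefix   : List Bool
    rightRun : ℕ
    leftRun  : ℕ
    left≡    : p ≡ prefix ++ false ∷ replicate rightRun true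
    right≡   : q ≡ prefix ++ true ∷ replicate leftRun false

Adjacent-∷ : ∀ β {p q} → Adjacent p q → Adjacent (β ∷ p) (β ∷ q)
Adjacent-∷ β A = record
  { prefix = β ∷ prefix ; rightRun = rightRun ; leftRun = leftRun
  ; left≡ = ≡.cong (β ∷_) left≡ ; right≡ = ≡.cong (β ∷_) right≡ }
  where open Adjacent A

adjacent-paths : ∀ {n} (T : BinTree n) h i → suc (toℕ h) ≡ toℕ i → Adjacent (path T h) (path T i)
adjacent-paths leaf           zero zero ()
adjacent-paths (node {m} L R) h i h+1≡i with splitAt m h in eh | splitAt m i in ei
... | inj₁ jh | inj₁ ji = Adjacent-∷ false (adjacent-paths L jh ji
        (≡.trans (≡.cong suc (≡.sym (splitAt-inj₁⇒toℕ≡ eh))) (≡.trans h+1≡i (splitAt-inj₁⇒toℕ≡ ei))))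
... | inj₂ jh | inj₂ ji = Adjacent-∷ true (adjacent-paths R jh ji (ℕ.+-cancelˡ-≡ m _ _
        (≡.trans (ℕ.+-suc m (toℕ jh)) (≡.trans (≡.cong suc (≡.sym (splitAt-inj₂⇒toℕ≡ eh)))
                                                (≡.trans h+1≡i (splitAt-inj₂⇒toℕ≡ ei))))))
... | inj₁ jh | inj₂ ji = record
  { prefix = [] ; rightRun = proj₁ last ; leftRun = proj₁ first
  ; left≡ = ≡.cong (false ∷_) (proj₂ last) ; right≡ = ≡.cong (true ∷_) (proj₂ first) }
  where
  jh+1≡m+ji : suc (toℕ jh) ≡ m +ℕ toℕ ji
  jh+1≡m+ji = ≡.trans (≡.cong suc (≡.sym (splitAt-inj₁⇒toℕ≡ eh))) (≡.trans h+1≡i (splitAt-inj₂⇒toℕ≡ ei))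
  ji≡0 : toℕ ji ≡ 0
  ji≡0 = ℕ.n≤0⇒n≡0 (ℕ.+-cancelˡ-≤ m _ _ (ℕ.≤-trans (ℕ.≤-reflexive (≡.sym jh+1≡m+ji))
                                          (ℕ.≤-trans (toℕ<n jh) (ℕ.≤-reflexive (≡.sym (ℕ.+-identityʳ m))))))
  last  = last-path L jh (≡.trans jh+1≡m+ji (≡.trans (≡.cong (m +ℕ_) ji≡0) (ℕ.+-identityʳ m)))
  first = first-path R ji ji≡0
... | inj₂ jh | inj₁ ji = contradiction (ℕ.≤-trans (s≤s (ℕ.m≤m+n m (toℕ jh))) jh+m<m) (ℕ.n≮n m)
  where
  jh+m<m : suc (m +ℕ toℕ jh) ≤ m
  jh+m<m = ℕ.≤-trans (ℕ.≤-reflexive (≡.trans (≡.cong suc (≡.sym (splitAt-inj₂⇒toℕ≡ eh)))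
                                        (≡.trans h+1≡i (splitAt-inj₁⇒toℕ≡ ei)))) (ℕ.<⇒≤ (toℕ<n ji))

genΛ-from-depths : ∀ {n} (T T' : BinTree n) i {l l' r r'} →
                   ld T i ≡ l → ld T' i ≡ l' → rd T i ≡ r → rd T' i ≡ r' →
                   genΛ T T' i ≡ (+ l - + l' , + r - + r')
genΛ-from-depths T T' i ≡.refl ≡.refl ≡.refl ≡.refl = ≡.refl

ld-path : ∀ {n} (T : BinTree n) i {w} → path T i ≡ w → ld T i ≡ lefts w
ld-path T i p = ≡.trans (ld≡lefts∘path T i) (≡.cong lefts p)

rd-path : ∀ {n} (T : BinTree n) i {w} → path T i ≡ w → rd T i ≡ rights w
rd-path T i p = ≡.trans (rd≡rights∘path T i) (≡.cong rights p)

genΛ-first : ∀ {n} (T T' : BinTree n) i {l l'} →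
             path T i ≡ replicate l false → path T' i ≡ replicate l' false →
             genΛ T T' i ≡ (+ l - + l' , +0)
genΛ-first T T' i {l} {l'} p p' = genΛ-from-depths T T' i
  (≡.trans (ld-path T i p) (lefts-replicate-false l)) (≡.trans (ld-path T' i p') (lefts-replicate-false l'))
  (≡.trans (rd-path T i p) (rights-replicate-false l)) (≡.trans (rd-path T' i p') (rights-replicate-false l'))

module _ {n} (T : BinTree n) {h i} (A : Adjacent (path T h) (path T i)) where
  open Adjacent A

  ld-adjacentˡ : ld T h ≡ lefts prefix +ℕ 1
  ld-adjacentˡ = ≡.trans (ld-path T h left≡)
    (≡.trans (lefts-++ prefix _) (≡.cong (λ z → lefts prefix +ℕ suc z) (lefts-replicate-true rightRun)))

  rd-adjacentˡ : rd T h ≡ rights prefix +ℕ rightRun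
  rd-adjacentˡ = ≡.trans (rd-path T h left≡)
    (≡.trans (rights-++ prefix _) (≡.cong (rights prefix +ℕ_) (rights-replicate-true rightRun)))

  ld-adjacentʳ : ld T i ≡ lefts prefix +ℕ leftRun
  ld-adjacentʳ = ≡.trans (ld-path T i right≡)
    (≡.trans (lefts-++ prefix _) (≡.cong (lefts prefix +ℕ_) (lefts-replicate-false leftRun)))

  rd-adjacentʳ : rd T i ≡ rights prefix +ℕ 1
  rd-adjacentʳ = ≡.trans (rd-path T i right≡)
    (≡.trans (rights-++ prefix _) (≡.cong (λ z → rights prefix +ℕ suc z) (rights-replicate-false leftRun)))

genΛ-adjacent : ∀ {n} (T T' : BinTree n) {h i}
                (A : Adjacent (path T h) (path T i)) (A' : Adjacent (path T' h) (path T' i)) →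
                let open Adjacent in
                genΛ T T' i ≡ genΛ T T' h ⊕ (+ leftRun A - + leftRun A' , + rightRun A' - + rightRun A)
genΛ-adjacent T T' {h} {i} A A' = begin
  genΛ T T' i
    ≡⟨ genΛ-from-depths T T' i (ld-adjacentʳ T A) (ld-adjacentʳ T' A') (rd-adjacentʳ T A) (rd-adjacentʳ T' A') ⟩
  (+ (L +ℕ m) - + (L' +ℕ m') , + (R +ℕ 1) - + (R' +ℕ 1))
    ≡⟨ ≡.cong₂ _,_ (shift₁ L L' m m') (shift₂ R R' k k') ⟩
  (+ (L +ℕ 1) - + (L' +ℕ 1) , + (R +ℕ k) - + (R' +ℕ k')) ⊕ (+ m - + m' , + k' - + k)
    ≡⟨ ≡.cong (_⊕ (+ m - + m' , + k' - + k))
         (genΛ-from-depths T T' h (ld-adjacentˡ T A) (ld-adjacentˡ T' A') (rd-adjacentˡ T A) (rd-adjacentˡ T' A')) ⟨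
  genΛ T T' h ⊕ (+ m - + m' , + k' - + k)
    ∎
  where
  open ≡.≡-Reasoning
  open Adjacent
  L = lefts (prefix A)
  L' = lefts (prefix A')
  R = rights (prefix A)
  R' = rights (prefix A')
  m = leftRun A
  m' = leftRun A'
  k = rightRun A
  k' = rightRun A'

  shift₁ : ∀ l l' p p' → + (l +ℕ p) - + (l' +ℕ p') ≡ (+ (l +ℕ 1) - + (l' +ℕ 1)) + (+ p - + p')
  shift₁ l l' p p' rewrite ℤ.pos-+ l p | ℤ.pos-+ l' p' | ℤ.pos-+ l 1 | ℤ.pos-+ l' 1 =
    identity (+ l) (+ l') (+ p) (+ p')
    where
    identity : ∀ i i' j j' → (i + j) - (i' + j') ≡ ((i + 1ℤ) - (i' + 1ℤ)) + (j - j')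
    identity = solve-∀

  shift₂ : ∀ r r' q q' → + (r +ℕ 1) - + (r' +ℕ 1) ≡ (+ (r +ℕ q) - + (r' +ℕ q')) + (+ q' - + q)
  shift₂ r r' q q' rewrite ℤ.pos-+ r q | ℤ.pos-+ r' q' | ℤ.pos-+ r 1 | ℤ.pos-+ r' 1 =
    identity (+ r) (+ r') (+ q) (+ q')
    where
    identity : ∀ i i' j j' → (i + 1ℤ) - (i' + 1ℤ) ≡ ((i + j) - (i' + j')) + (j' - j)
    identity = solve-∀

all⇔all-by-successor : ∀ {n} {P Q : Fin n → Set ℓ} →
                       (∀ i → toℕ i ≡ 0 → P i ⇔ Q i) →
                       (∀ h i → suc (toℕ h) ≡ toℕ i → P h → Q h → P i ⇔ Q i) →
                       (∀ i → P i) ⇔ (∀ i → Q i)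
all⇔all-by-successor {n = zero}  first step = mk⇔ (λ _ ()) (λ _ ())
all⇔all-by-successor {n = suc n} {P} {Q} first step = mk⇔
  (λ allP → <-weakInduction Q (Equivalence.to (first zero ≡.refl) (allP zero))
              (λ j Qj → Equivalence.to (step (inject₁ j) (suc j) (successor j) (allP _) Qj) (allP (suc j))))
  (λ allQ → <-weakInduction P (Equivalence.from (first zero ≡.refl) (allQ zero))
              (λ j Pj → Equivalence.from (step (inject₁ j) (suc j) (successor j) Pj (allQ _)) (allQ (suc j))))
  where
  successor : ∀ j → suc (toℕ (inject₁ j)) ≡ toℕ (suc j)
  successor j = ≡.cong suc (toℕ-inject₁ j)

-- Words along the leaf paths of a tree, in an arbitrary group

module TreeWords (H : Group c ℓ) (letter : Bool → Group.Carrier H) where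

  open Group H hiding (_-_)
  open IntegerPowers H
  open Conjugation H
  open GroupEquations H
  open import Algebra.Properties.Group H using (\\-leftDividesʳ)

  a b : Carrier
  a = letter false
  b = letter true

  word : List Bool → Carrier
  word []      = ε
  word (β ∷ w) = letter β ∙ word w

  word-++ : ∀ u v → word (u ++ v) ≈ word u ∙ word v
  word-++ []      v = sym (identityˡ _)
  word-++ (β ∷ u) v = trans (∙-congˡ (word-++ u v)) (sym (assoc _ _ _))

  word-replicate : ∀ β k → word (replicate k β) ≈ letter β ^ + k
  word-replicate β zero    = refl
  word-replicate β (suc k) = ∙-congˡ (word-replicate β k)

  word-turn : ∀ u β γ k → word (u ++ β ∷ replicate k γ) ≈ word u ∙ (letter β ∙ letter γ ^ + k)
  word-turn u β γ k = trans (word-++ u _) (∙-congˡ (∙-congˡ (word-replicate γ k)))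

  -- When a and b commute this says a ^ α ∙ b ^ β ≈ ε.
  Balanced : ℤ × ℤ → Set ℓ
  Balanced v = conj a (b ^ proj₂ v) ≈ conj b (a ^ (- proj₁ v))

  Balanced-isSubgroup : IsSubgroup Balanced
  Balanced-isSubgroup = record
    { 0∈ = trans (conj-ε a) (sym (conj-ε b)) ; ⊕-closed = λ {v} {w} → ⊕-closed {v} {w} ; ⊖-closed = λ {v} → ⊖-closed {v} }
    where
    open import Relation.Binary.Reasoning.Setoid setoid

    ⊕-closed : ∀ {v w} → Balanced v → Balanced w → Balanced (v ⊕ w)
    ⊕-closed {α , β} {γ , δ} v-bal w-bal = begin
      conj a (b ^ (β + δ))                     ≈⟨ conj-cong a (^-+ b β δ) ⟩
      conj a (b ^ β ∙ b ^ δ)                   ≈⟨ conj-∙ a _ _ ⟩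
      conj a (b ^ β) ∙ conj a (b ^ δ)          ≈⟨ ∙-cong v-bal w-bal ⟩
      conj b (a ^ (- α)) ∙ conj b (a ^ (- γ))  ≈⟨ conj-∙ b _ _ ⟨
      conj b (a ^ (- α) ∙ a ^ (- γ))           ≈⟨ conj-cong b (^-+ a (- α) (- γ)) ⟨
      conj b (a ^ (- α + - γ))                 ≈⟨ conj-cong b (^-congʳ a (ℤ.neg-distrib-+ α γ)) ⟨
      conj b (a ^ (- (α + γ)))                 ∎

    ⊖-closed : ∀ {v} → Balanced v → Balanced (⊖ v)
    ⊖-closed {α , β} v-bal = begin
      conj a (b ^ (- β))        ≈⟨ conj-cong a (^-neg b β) ⟩
      conj a ((b ^ β) ⁻¹)       ≈⟨ conj-⁻¹ a _ ⟩
      conj a (b ^ β) ⁻¹         ≈⟨ ⁻¹-cong v-bal ⟩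
      conj b (a ^ (- α)) ⁻¹     ≈⟨ conj-⁻¹ b _ ⟨
      conj b ((a ^ (- α)) ⁻¹)   ≈⟨ conj-cong b (^-neg a (- α)) ⟨
      conj b (a ^ (- - α))      ∎

  -- The hypothesis means U' \\ U ≈ conj a (b ^ (k' - k)), the left-hand equation U' \\ U ≈ conj b (a ^ (m' - m)).
  agreement-step : ∀ U U' k k' m m' → U ∙ (a ∙ b ^ k) ≈ U' ∙ (a ∙ b ^ k') →
                   (U ∙ (b ∙ a ^ m) ≈ U' ∙ (b ∙ a ^ m')) ⇔ Balanced (m - m' , k' - k)
  agreement-step U U' k k' m m' first-agree = begin
    (U ∙ (b ∙ a ^ m) ≈ U' ∙ (b ∙ a ^ m'))         ≈⟨ ∙≈∙⇔\\≈// U _ U' _ ⟩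
    (U' \\ U ≈ (b ∙ a ^ m') // (b ∙ a ^ m))       ≈⟨ ≈-resp-⇔ quotient≈ right≈ ⟩
    Balanced (m - m' , k' - k)                    ∎
    where
    open import Relation.Binary.Reasoning.Setoid (⇔-setoid ℓ)

    quotient≈ : U' \\ U ≈ conj a (b ^ (k' - k))
    quotient≈ = trans (Equivalence.to (∙≈∙⇔\\≈// U _ U' _) first-agree)
                      (trans (//-conj a _ _) (conj-cong a (^-// b k k')))

    right≈ : (b ∙ a ^ m') // (b ∙ a ^ m) ≈ conj b (a ^ (- (m - m')))
    right≈ = trans (//-conj b _ _) (conj-cong b (trans (^-// a m m') (^-congʳ a (minus-swap m' m))))
      where
      minus-swap : ∀ i j → i - j ≡ - (j - i)
      minus-swap = solve-∀

  agreement-first : ∀ l l' → (a ^ l ≈ a ^ l') ⇔ Balanced (l - l' , +0)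
  agreement-first l l' = begin
    (a ^ l ≈ a ^ l')                                  ≈⟨ ≈-resp-⇔ (cancel l) (cancel l') ⟩
    (b ⁻¹ ∙ (b ∙ a ^ l) ≈ b ⁻¹ ∙ (b ∙ a ^ l'))        ≈⟨ agreement-step (b ⁻¹) (b ⁻¹) +0 +0 l l' refl ⟩
    Balanced (l - l' , +0)                            ∎
    where
    open import Relation.Binary.Reasoning.Setoid (⇔-setoid ℓ)
    cancel : ∀ i → a ^ i ≈ b ⁻¹ ∙ (b ∙ a ^ i)
    cancel i = sym (\\-leftDividesʳ b (a ^ i))

  module _ {n} (S : BinTree n) {h i} (A : Adjacent (path S h) (path S i)) where
    open Adjacent A

    word-adjacentˡ : word (path S h) ≈ word prefix ∙ (a ∙ b ^ + rightRun)
    word-adjacentˡ = trans (reflexive (≡.cong word left≡)) (word-turn prefix false true rightRun)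

    word-adjacentʳ : word (path S i) ≈ word prefix ∙ (b ∙ a ^ + leftRun)
    word-adjacentʳ = trans (reflexive (≡.cong word right≡)) (word-turn prefix true false leftRun)

  module _ {n} (T T' : BinTree n) where

    Agree : Fin n → Set ℓ
    Agree i = word (path T i) ≈ word (path T' i)

    agree-first : ∀ i → toℕ i ≡ 0 → Agree i ⇔ Balanced (genΛ T T' i)
    agree-first i i≡0 = begin
      Agree i                      ≈⟨ ≈-resp-⇔ (word-first T p) (word-first T' p') ⟩
      (a ^ + l ≈ a ^ + l')         ≈⟨ agreement-first (+ l) (+ l') ⟩
      Balanced (+ l - + l' , +0)   ≡⟨ ≡.cong Balanced (genΛ-first T T' i p p') ⟨
      Balanced (genΛ T T' i)       ∎
      where
      open import Relation.Binary.Reasoning.Setoid (⇔-setoid ℓ)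
      l  = proj₁ (first-path T i i≡0)
      p  = proj₂ (first-path T i i≡0)
      l' = proj₁ (first-path T' i i≡0)
      p' = proj₂ (first-path T' i i≡0)
      word-first : ∀ (S : BinTree n) {k} → path S i ≡ replicate k false → word (path S i) ≈ a ^ + k
      word-first S {k} q = trans (reflexive (≡.cong word q)) (word-replicate false k)

    agree-step : ∀ h i → suc (toℕ h) ≡ toℕ i → Agree h → Balanced (genΛ T T' h) →
                 Agree i ⇔ Balanced (genΛ T T' i)
    agree-step h i h+1≡i agree-h balanced-h = begin
      Agree i
        ≈⟨ ≈-resp-⇔ (word-adjacentʳ T A) (word-adjacentʳ T' A') ⟩
      (word (prefix A) ∙ (b ∙ a ^ + leftRun A) ≈ word (prefix A') ∙ (b ∙ a ^ + leftRun A'))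
        ≈⟨ agreement-step (word (prefix A)) (word (prefix A'))
             (+ rightRun A) (+ rightRun A') (+ leftRun A) (+ leftRun A')
             (Equivalence.to (≈-resp-⇔ (word-adjacentˡ T A) (word-adjacentˡ T' A')) agree-h) ⟩
      Balanced δ
        ≈⟨ IsSubgroup.⊕-cancelˡ Balanced-isSubgroup {genΛ T T' h} {δ} balanced-h ⟨
      Balanced (genΛ T T' h ⊕ δ)
        ≡⟨ ≡.cong Balanced (genΛ-adjacent T T' A A') ⟨
      Balanced (genΛ T T' i)
        ∎
      where
      open import Relation.Binary.Reasoning.Setoid (⇔-setoid ℓ)
      open Adjacent
      A  = adjacent-paths T h i h+1≡i
      A' = adjacent-paths T' h i h+1≡i
      δ  = (+ leftRun A - + leftRun A' , + rightRun A' - + rightRun A)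

    agree⇔Λ⊆Balanced : (∀ i → Agree i) ⇔ (∀ v → Λ T T' v → Balanced v)
    agree⇔Λ⊆Balanced = begin
      (∀ i → Agree i)                     ≈⟨ all⇔all-by-successor agree-first agree-step ⟩
      (∀ i → Balanced (genΛ T T' i))      ≈⟨ mk⇔ (Λ-minimal Balanced-isSubgroup) (λ Λ⊆ i → Λ⊆ _ (gen i)) ⟩
      (∀ v → Λ T T' v → Balanced v)       ∎
      where open import Relation.Binary.Reasoning.Setoid (⇔-setoid ℓ)

permutationGroup : Setoid c ℓ → Group (c ⊔ ℓ) (c ⊔ ℓ)
permutationGroup S = record
  { Carrier = Inverse S S
  ; _≈_     = λ f g → ∀ s → Inverse.to f s ≈ Inverse.to g s
  ; _∙_     = λ f g → Composition.inverse g f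
  ; ε       = Identity.inverse S
  ; _⁻¹     = Symmetry.inverse
  ; isGroup = record
    { isMonoid = record
      { isSemigroup = record
        { isMagma = record
          { isEquivalence = record
            { refl  = λ _ → refl
            ; sym   = λ f≈g s → sym (f≈g s)
            ; trans = λ f≈g g≈h s → trans (f≈g s) (g≈h s) }
          ; ∙-cong = λ {f} f≈f' g≈g' s → trans (Inverse.to-cong f (g≈g' s)) (f≈f' _) }
        ; assoc = λ _ _ _ _ → refl }
      ; identity = (λ _ _ → refl) , (λ _ _ → refl) }
    ; inverse = (λ f _ → Inverse.inverseʳ f refl) , (λ f _ → Inverse.inverseˡ f refl)
    ; ⁻¹-cong = λ {f} {g} f≈g s →
        sym (Inverse.inverseʳ g (trans (sym (Inverse.inverseˡ f refl)) (f≈g (Inverse.from f s)))) } }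
  where open Setoid S

module MonoidSums (M : Monoid c ℓ) where

  open Monoid M
  open import Algebra.Properties.Monoid.Sum M using (sum; sum-cong-≋; sum-replicate-zero)

  sum-↑ : ∀ m k (v : Vector Carrier (m +ℕ k)) → sum v ≈ sum (v ∘ (_↑ˡ k)) ∙ sum (v ∘ (m ↑ʳ_))
  sum-↑ zero    k v = sym (identityˡ _)
  sum-↑ (suc m) k v = trans (∙-congˡ (sum-↑ m k (v ∘ suc))) (sym (assoc _ _ _))

  sum-homo : ∀ (f : Carrier → Carrier) → (∀ y z → f (y ∙ z) ≈ f y ∙ f z) → f ε ≈ ε →
             ∀ {n} (v : Vector Carrier n) → f (sum v) ≈ sum (f ∘ v)
  sum-homo f f-∙ f-ε {zero}  v = f-ε
  sum-homo f f-∙ f-ε {suc n} v = trans (f-∙ _ _) (∙-congˡ (sum-homo f f-∙ f-ε (v ∘ suc)))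

  sum-support : ∀ {n} (v : Vector Carrier n) i → (∀ j → j ≢ i → v j ≈ ε) → sum v ≈ v i
  sum-support {suc n} v zero    vanish = trans (∙-congˡ rest≈ε) (identityʳ _)
    where
    rest≈ε : sum (v ∘ suc) ≈ ε
    rest≈ε = trans (sum-cong-≋ (λ j → vanish (suc j) λ ())) (sum-replicate-zero n)
  sum-support {suc n} v (suc i) vanish =
    trans (∙-cong (vanish zero λ ())
                  (sum-support (v ∘ suc) i λ j j≢i → vanish (suc j) (j≢i ∘ suc-injective)))
          (identityˡ _)

-- Term operations of linear quasigroups

module TermOperations (A : LinearQuasigroup) where

  open LinearQuasigroup A using (G; φ₀; φ₁; φ₀-aut; φ₁-aut)
  open Group G hiding (_-_)
  open MonoidSums monoid
  open import Algebra.Properties.Monoid.Sum monoid using (sum; sum-cong-≋)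

  φ : Bool → Carrier → Carrier
  φ false = φ₀
  φ true  = φ₁

  φ-aut : ∀ β → IsAutomorphism G (φ β)
  φ-aut false = φ₀-aut
  φ-aut true  = φ₁-aut

  module φ β = GroupMorphisms.IsGroupIsomorphism (φ-aut β)

  permutation : Bool → Inverse setoid setoid
  permutation β = Bijection⇒Inverse (record
    { to = φ β ; cong = φ.⟦⟧-cong β ; bijective = φ.injective β , φ.surjective β })

  -- Words in φ₀ and φ₁ are evaluated in the group of permutations of the carrier.
  open TreeWords (permutationGroup setoid) permutation public

  act : List Bool → Carrier → Carrier
  act w = Inverse.to (word w)

  act-∙ : ∀ w y z → act w (y ∙ z) ≈ act w y ∙ act w z
  act-∙ []      y z = refl
  act-∙ (β ∷ w) y z = trans (φ.⟦⟧-cong β (act-∙ w y z)) (φ.∙-homo β _ _)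

  act-ε : ∀ w → act w ε ≈ ε
  act-ε []      = refl
  act-ε (β ∷ w) = trans (φ.⟦⟧-cong β (act-ε w)) (φ.ε-homo β)

  evalIn≈sum : ∀ {n} (t : Bracketing n) ρ → evalIn A t ρ ≈ sum (λ i → act (path (τ t) i) (ρ i))
  evalIn≈sum x ρ = sym (identityʳ _)
  evalIn≈sum (_·_ {m} {k} s₁ s₂) ρ = begin
    φ₀ (evalIn A s₁ (ρ ∘ (_↑ˡ k))) ∙ φ₁ (evalIn A s₂ (ρ ∘ (m ↑ʳ_)))
      ≈⟨ ∙-cong (φ.⟦⟧-cong false (evalIn≈sum s₁ _)) (φ.⟦⟧-cong true (evalIn≈sum s₂ _)) ⟩
    φ₀ (sum (λ i → act (path T₁ i) (ρ (i ↑ˡ k)))) ∙ φ₁ (sum (λ i → act (path T₂ i) (ρ (m ↑ʳ i))))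
      ≈⟨ ∙-cong (sum-homo φ₀ (φ.∙-homo false) (φ.ε-homo false) {m} _)
                (sum-homo φ₁ (φ.∙-homo true) (φ.ε-homo true) {k} _) ⟩
    sum (λ i → φ₀ (act (path T₁ i) (ρ (i ↑ˡ k)))) ∙ sum (λ i → φ₁ (act (path T₂ i) (ρ (m ↑ʳ i))))
      ≈⟨ ∙-cong (sum-cong-≋ λ i → reflexive (≡.cong (λ w → act w (ρ (i ↑ˡ k))) (path-↑ˡ T₁ T₂ i)))
                (sum-cong-≋ λ i → reflexive (≡.cong (λ w → act w (ρ (m ↑ʳ i))) (path-↑ʳ T₁ T₂ i))) ⟨
    sum (λ i → act (path T (i ↑ˡ k)) (ρ (i ↑ˡ k))) ∙ sum (λ i → act (path T (m ↑ʳ i)) (ρ (m ↑ʳ i)))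
      ≈⟨ sum-↑ m k _ ⟨
    sum (λ i → act (path T i) (ρ i))
      ∎
    where
    open import Relation.Binary.Reasoning.Setoid setoid
    T₁ = τ s₁
    T₂ = τ s₂
    T  = τ (s₁ · s₂)

  sum-at-single : ∀ {n} (w : Fin n → List Bool) i g →
                  sum (λ j → act (w j) (updateAt (const ε) i (const g) j)) ≈ act (w i) g
  sum-at-single w i g = trans
    (sum-support _ i λ j j≢i → trans (reflexive (≡.cong (act (w j)) (updateAt-minimal j i (const ε) j≢i)))
                                     (act-ε (w j)))
    (reflexive (≡.cong (act (w i)) (updateAt-updates i (const ε))))

  satisfies⇔agree : ∀ {n} (t t' : Bracketing n) → Satisfies A t t' ⇔ (∀ i → Agree (τ t) (τ t') i)
  satisfies⇔agree {n} t t' = mk⇔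
    (λ sat i g → begin
      act (path (τ t) i) g                                  ≈⟨ sum-at-single (path (τ t)) i g ⟨
      sum (λ j → act (path (τ t) j) (single i g j))         ≈⟨ evalIn≈sum t (single i g) ⟨
      evalIn A t (single i g)                               ≈⟨ sat (single i g) ⟩
      evalIn A t' (single i g)                              ≈⟨ evalIn≈sum t' (single i g) ⟩
      sum (λ j → act (path (τ t') j) (single i g j))        ≈⟨ sum-at-single (path (τ t')) i g ⟩
      act (path (τ t') i) g                                 ∎)
    (λ agree ρ → trans (evalIn≈sum t ρ) (trans (sum-cong-≋ (λ i → agree i (ρ i))) (sym (evalIn≈sum t' ρ))))
    where
    open import Relation.Binary.Reasoning.Setoid setoid
    single : Fin n → Carrier → Vector Carrier n
    single i g = updateAt (const ε) i (const g)

  satisfies⇔Λ⊆Balanced : ∀ {n} (t t' : Bracketing n) → Satisfies A t t' ⇔ (Λ (τ t) (τ t') ⊆Λ Balanced)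
  satisfies⇔Λ⊆Balanced t t' = Composition.equivalence (satisfies⇔agree t t') (agree⇔Λ⊆Balanced (τ t) (τ t'))

-- Every subgroup of ℤ² is the set of balanced pairs of a linear quasigroup

⊕-assoc : ∀ u v w → u ⊕ v ⊕ w ≡ u ⊕ (v ⊕ w)
⊕-assoc u v w = ≡.cong₂ _,_ (ℤ.+-assoc (proj₁ u) (proj₁ v) (proj₁ w)) (ℤ.+-assoc (proj₂ u) (proj₂ v) (proj₂ w))

⊕-identityˡ : ∀ v → (+0 , +0) ⊕ v ≡ v
⊕-identityˡ v = ≡.cong₂ _,_ (ℤ.+-identityˡ (proj₁ v)) (ℤ.+-identityˡ (proj₂ v))

⊕-identityʳ : ∀ v → v ⊕ (+0 , +0) ≡ v
⊕-identityʳ v = ≡.cong₂ _,_ (ℤ.+-identityʳ (proj₁ v)) (ℤ.+-identityʳ (proj₂ v))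

⊕-inverseˡ : ∀ v → ⊖ v ⊕ v ≡ (+0 , +0)
⊕-inverseˡ v = ≡.cong₂ _,_ (ℤ.+-inverseˡ (proj₁ v)) (ℤ.+-inverseˡ (proj₂ v))

⊕-inverseʳ : ∀ v → v ⊕ ⊖ v ≡ (+0 , +0)
⊕-inverseʳ v = ≡.cong₂ _,_ (ℤ.+-inverseʳ (proj₁ v)) (ℤ.+-inverseʳ (proj₂ v))

module ShiftQuasigroup {Q : ℤ × ℤ → Set} (Q-subgroup : IsSubgroup Q) where

  open IsSubgroup Q-subgroup

  infix 4 _∼_

  record _∼_ (v w : ℤ × ℤ) : Set where
    constructor by-difference
    field difference∈Q : Q (v ⊕ ⊖ w)

  open _∼_

  private
    Q-cong : ∀ {v w} → proj₁ v ≡ proj₁ w → proj₂ v ≡ proj₂ w → Q v → Q w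
    Q-cong p q = ≡.subst Q (≡.cong₂ _,_ p q)

  ∼-refl : ∀ {v} → v ∼ v
  ∼-refl {v} = by-difference (≡.subst Q (≡.sym (⊕-inverseʳ v)) 0∈)

  ∼-reflexive : ∀ {v w} → v ≡ w → v ∼ w
  ∼-reflexive ≡.refl = ∼-refl

  ∼-sym : ∀ {v w} → v ∼ w → w ∼ v
  ∼-sym {v} {w} (by-difference d) =
    by-difference (Q-cong (identity (proj₁ v) (proj₁ w)) (identity (proj₂ v) (proj₂ w)) (⊖-closed d))
    where
    identity : ∀ i j → - (i + - j) ≡ j + - i
    identity = solve-∀

  ∼-trans : ∀ {u v w} → u ∼ v → v ∼ w → u ∼ w
  ∼-trans {u} {v} {w} (by-difference d) (by-difference e) = by-difference (Q-cong
    (identity (proj₁ u) (proj₁ v) (proj₁ w)) (identity (proj₂ u) (proj₂ v) (proj₂ w)) (⊕-closed d e))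
    where
    identity : ∀ i j k → (i + - j) + (j + - k) ≡ i + - k
    identity = solve-∀

  ∼-⊕ : ∀ {v v' w w'} → v ∼ v' → w ∼ w' → v ⊕ w ∼ v' ⊕ w'
  ∼-⊕ {v} {v'} {w} {w'} (by-difference d) (by-difference e) = by-difference (Q-cong
    (identity (proj₁ v) (proj₁ v') (proj₁ w) (proj₁ w')) (identity (proj₂ v) (proj₂ v') (proj₂ w) (proj₂ w'))
    (⊕-closed d e))
    where
    identity : ∀ i i' j j' → (i + - i') + (j + - j') ≡ (i + j) + - (i' + j')
    identity = solve-∀

  ∼-⊖ : ∀ {v w} → v ∼ w → ⊖ v ∼ ⊖ w
  ∼-⊖ {v} {w} (by-difference d) =
    by-difference (Q-cong (identity (proj₁ v) (proj₁ w)) (identity (proj₂ v) (proj₂ w)) (⊖-closed d))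
    where
    identity : ∀ i j → - (i + - j) ≡ - i + - - j
    identity = solve-∀

  -- Maps (ℤ² / Q) → (ℤ² / Q), with pointwise addition.
  record Map : Set where
    field
      app      : ℤ × ℤ → ℤ × ℤ
      app-cong : ∀ {v w} → v ∼ w → app v ∼ app w

  open Map

  app-cong≡ : ∀ F {v w} → v ≡ w → app F v ∼ app F w
  app-cong≡ F = app-cong F ∘ ∼-reflexive

  mapGroup : Group 0ℓ 0ℓ
  mapGroup = record
    { Carrier = Map
    ; _≈_     = λ F G → ∀ v → app F v ∼ app G v
    ; _∙_     = λ F G → record { app = λ v → app F v ⊕ app G v ; app-cong = λ p → ∼-⊕ (app-cong F p) (app-cong G p) }
    ; ε       = record { app = const (+0 , +0) ; app-cong = const ∼-refl }
    ; _⁻¹     = λ F → record { app = ⊖_ ∘ app F ; app-cong = ∼-⊖ ∘ app-cong F }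
    ; isGroup = record
      { isMonoid = record
        { isSemigroup = record
          { isMagma = record
            { isEquivalence = record
              { refl  = λ _ → ∼-refl
              ; sym   = λ F≈G v → ∼-sym (F≈G v)
              ; trans = λ F≈G G≈H v → ∼-trans (F≈G v) (G≈H v) }
            ; ∙-cong = λ F≈F' G≈G' v → ∼-⊕ (F≈F' v) (G≈G' v) }
          ; assoc = λ F G H v → ∼-reflexive (⊕-assoc (app F v) (app G v) (app H v)) }
        ; identity = (λ F v → ∼-reflexive (⊕-identityˡ (app F v))) , (λ F v → ∼-reflexive (⊕-identityʳ (app F v))) }
      ; inverse = (λ F v → ∼-reflexive (⊕-inverseˡ (app F v))) , (λ F v → ∼-reflexive (⊕-inverseʳ (app F v)))
      ; ⁻¹-cong = λ F≈G v → ∼-⊖ (F≈G v) } }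

  open Group mapGroup using () renaming (_≈_ to _≈ₘ_)

  shift : ℤ × ℤ → Map → Map
  shift c F = record { app = λ v → app F (v ⊕ c) ; app-cong = λ v∼w → app-cong F (∼-⊕ v∼w ∼-refl) }

  shift-cong : ∀ c F G → F ≈ₘ G → shift c F ≈ₘ shift c G
  shift-cong c F G F≈G v = F≈G (v ⊕ c)

  shift-∼ : ∀ {c d} F → c ∼ d → shift c F ≈ₘ shift d F
  shift-∼ F c∼d v = app-cong F (∼-⊕ (∼-refl {v}) c∼d)

  shift-⊕ : ∀ c d F → shift c (shift d F) ≈ₘ shift (c ⊕ d) F
  shift-⊕ c d F v = app-cong≡ F (⊕-assoc v c d)

  shift-inverse : ∀ c d F → c ⊕ d ≡ (+0 , +0) → shift c (shift d F) ≈ₘ F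
  shift-inverse c d F c⊕d≡0 v =
    app-cong≡ F (≡.trans (⊕-assoc v c d) (≡.trans (≡.cong (v ⊕_) c⊕d≡0) (⊕-identityʳ v)))

  shift-isAutomorphism : ∀ c → IsAutomorphism mapGroup (shift c)
  shift-isAutomorphism c = record
    { isGroupMonomorphism = record
      { isGroupHomomorphism = record
        { isMonoidHomomorphism = record
          { isMagmaHomomorphism = record
            { isRelHomomorphism = record { cong = λ {F} {G} → shift-cong c F G }
            ; homo = λ F G v → ∼-refl {app F (v ⊕ c) ⊕ app G (v ⊕ c)} }
          ; ε-homo = λ _ → ∼-refl {+0 , +0} }
        ; ⁻¹-homo = λ F v → ∼-refl {⊖ app F (v ⊕ c)} }
      ; injective = λ {F} {G} shift-F≈shift-G v →
          ∼-trans (∼-sym (shift-inverse (⊖ c) c F (⊕-inverseˡ c) v))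
                  (∼-trans (shift-F≈shift-G (v ⊕ ⊖ c)) (shift-inverse (⊖ c) c G (⊕-inverseˡ c) v)) }
    ; surjective = λ F → shift (⊖ c) F , λ G≈ v → ∼-trans (G≈ (v ⊕ c)) (shift-inverse c (⊖ c) F (⊕-inverseʳ c) v) }

  shiftQuasigroup : LinearQuasigroup
  shiftQuasigroup = record
    { G = mapGroup ; φ₀ = shift (1ℤ , +0) ; φ₁ = shift (+0 , 1ℤ)
    ; φ₀-aut = shift-isAutomorphism (1ℤ , +0) ; φ₁-aut = shift-isAutomorphism (+0 , 1ℤ) }

  open TermOperations shiftQuasigroup using (Balanced; permutation)
  open Group (permutationGroup (Group.setoid mapGroup))
    using (_∙_; ε; _⁻¹; rawMonoid) renaming (Carrier to Permutation; _≈_ to _≈ₚ_)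
  open IntegerPowers (permutationGroup (Group.setoid mapGroup)) using (_^_)
  import Algebra.Definitions.RawMonoid rawMonoid as Multiple

  record IsShift (g : Permutation) (c : ℤ × ℤ) : Set where
    constructor acts-as-shift
    field acts : ∀ F → Inverse.to g F ≈ₘ shift c F

  open IsShift

  ε-isShift : IsShift ε (+0 , +0)
  ε-isShift = acts-as-shift λ F v → app-cong≡ F (≡.sym (⊕-identityʳ v))

  ∙-isShift : ∀ {g h c d} → IsShift g c → IsShift h d → IsShift (g ∙ h) (c ⊕ d)
  ∙-isShift {h = h} {c} {d} (acts-as-shift g-acts) (acts-as-shift h-acts) = acts-as-shift λ F v →
    ∼-trans (g-acts (Inverse.to h F) v) (∼-trans (shift-cong c (Inverse.to h F) (shift d F) (h-acts F) v) (shift-⊕ c d F v))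

  ⁻¹-isShift : ∀ {g c} → IsShift g c → IsShift (g ⁻¹) (⊖ c)
  ⁻¹-isShift {g} {c} (acts-as-shift g-acts) = acts-as-shift inverse-acts
    where
    inverse-acts : ∀ F → Inverse.from g F ≈ₘ shift (⊖ c) F
    inverse-acts F v = ∼-trans (∼-sym (shift-inverse (⊖ c) c g⁻¹F (⊕-inverseˡ c) v))
      (∼-trans (shift-cong (⊖ c) (shift c g⁻¹F) (Inverse.to g g⁻¹F) (λ w → ∼-sym (g-acts g⁻¹F w)) v)
               (shift-cong (⊖ c) (Inverse.to g g⁻¹F) F (Inverse.inverseˡ g {F} {g⁻¹F} (Group.refl mapGroup {g⁻¹F})) v))
      where g⁻¹F = Inverse.from g F

  isShift-resp : ∀ {g c d} → c ≡ d → IsShift g c → IsShift g d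
  isShift-resp ≡.refl g-shifts = g-shifts

  infixr 7 _⊙_

  _⊙_ : ℤ → ℤ × ℤ → ℤ × ℤ
  i ⊙ c = i * proj₁ c , i * proj₂ c

  ×-isShift : ∀ {g c} → IsShift g c → ∀ n → IsShift (n Multiple.× g) (+ n ⊙ c)
  ×-isShift g-shifts zero    = ε-isShift
  ×-isShift {c = c} g-shifts (suc n) =
    isShift-resp (≡.cong₂ _,_ (suc-* (+ n) (proj₁ c)) (suc-* (+ n) (proj₂ c)))
                 (∙-isShift g-shifts (×-isShift g-shifts n))
    where
    suc-* : ∀ i j → j + i * j ≡ (1ℤ + i) * j
    suc-* = solve-∀

  ^-isShift : ∀ {g c} → IsShift g c → ∀ i → IsShift (g ^ i) (i ⊙ c)
  ^-isShift g-shifts (+ n)              = ×-isShift g-shifts n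
  ^-isShift {c = c} g-shifts -[1+ n ] =
    isShift-resp (≡.cong₂ _,_ (neg-swap (+ suc n) (proj₁ c)) (neg-swap (+ suc n) (proj₂ c)))
                 (×-isShift (⁻¹-isShift g-shifts) (suc n))
    where
    neg-swap : ∀ i j → i * - j ≡ - i * j
    neg-swap = solve-∀

  isShift-≈⇔∼ : ∀ {g h c d} → IsShift g c → IsShift h d → (g ≈ₚ h ⇔ c ∼ d)
  isShift-≈⇔∼ {c = c} {d} (acts-as-shift g-acts) (acts-as-shift h-acts) = mk⇔
    (λ g≈h → ∼-trans (∼-reflexive (≡.sym (⊕-identityˡ c)))
               (∼-trans (∼-sym (g-acts identity origin)) (∼-trans (g≈h identity origin)
                 (∼-trans (h-acts identity origin) (∼-reflexive (⊕-identityˡ d))))))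
    (λ c∼d F v → ∼-trans (g-acts F v) (∼-trans (shift-∼ F c∼d v) (∼-sym (h-acts F v))))
    where
    identity : Map
    identity = record { app = λ v → v ; app-cong = λ v∼w → v∼w }
    origin : ℤ × ℤ
    origin = +0 , +0

  balanced⇔∈ : ∀ v → Balanced v ⇔ Q v
  balanced⇔∈ (α , β) = begin
    Balanced (α , β)                                      ≈⟨ isShift-≈⇔∼ (conj-isShift a-isShift (^-isShift b-isShift β))
                                                                          (conj-isShift b-isShift (^-isShift a-isShift (- α))) ⟩
    (lhs-shift ∼ rhs-shift)                               ≈⟨ mk⇔ difference∈Q by-difference ⟩
    Q (lhs-shift ⊕ ⊖ rhs-shift)                           ≡⟨ ≡.cong Q (≡.cong₂ _,_ (identity₁ α β) (identity₂ α β)) ⟩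
    Q (α , β)                                             ∎
    where
    open import Relation.Binary.Reasoning.Setoid (⇔-setoid 0ℓ)
    a-isShift : IsShift (permutation false) (1ℤ , +0)
    a-isShift = acts-as-shift λ _ _ → ∼-refl
    b-isShift : IsShift (permutation true) (+0 , 1ℤ)
    b-isShift = acts-as-shift λ _ _ → ∼-refl
    conj-isShift : ∀ {g h c d} → IsShift g c → IsShift h d → IsShift (g ∙ h ∙ g ⁻¹) (c ⊕ d ⊕ ⊖ c)
    conj-isShift g-shifts h-shifts = ∙-isShift (∙-isShift g-shifts h-shifts) (⁻¹-isShift g-shifts)
    lhs-shift = (1ℤ , +0) ⊕ β ⊙ (+0 , 1ℤ) ⊕ ⊖ (1ℤ , +0)
    rhs-shift = (+0 , 1ℤ) ⊕ (- α) ⊙ (1ℤ , +0) ⊕ ⊖ (+0 , 1ℤ)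
    identity₁ : ∀ α β → (1ℤ + β * +0 + - 1ℤ) + - (+0 + - α * 1ℤ + - +0) ≡ α
    identity₁ = solve-∀
    identity₂ : ∀ α β → (+0 + β * 1ℤ + - +0) + - (1ℤ + - α * +0 + - 1ℤ) ≡ β
    identity₂ = solve-∀

corollary6p10 : (n : ℕ) (t₁ t₁' t₂ t₂' : Bracketing n) →
    ((A : LinearQuasigroup) → Satisfies A t₁ t₁' → Satisfies A t₂ t₂')
    ⇔ (Λ (τ t₂) (τ t₂') ⊆Λ Λ (τ t₁) (τ t₁'))
corollary6p10 n t₁ t₁' t₂ t₂' = mk⇔ implication⇒inclusion inclusion⇒implication
  where
  open TermOperations using (satisfies⇔Λ⊆Balanced)
  open Equivalence

  implication⇒inclusion : ((A : LinearQuasigroup) → Satisfies A t₁ t₁' → Satisfies A t₂ t₂') →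
                          Λ (τ t₂) (τ t₂') ⊆Λ Λ (τ t₁) (τ t₁')
  implication⇒inclusion implication v v∈Λ₂ =
    to (balanced⇔∈ v) (to (satisfies⇔Λ⊆Balanced shiftQuasigroup t₂ t₂') sat₂ v v∈Λ₂)
    where
    open ShiftQuasigroup (Λ-isSubgroup (τ t₁) (τ t₁')) using (shiftQuasigroup; balanced⇔∈)
    sat₂ : Satisfies shiftQuasigroup t₂ t₂'
    sat₂ = implication shiftQuasigroup (from (satisfies⇔Λ⊆Balanced shiftQuasigroup t₁ t₁') (λ w → from (balanced⇔∈ w)))

  inclusion⇒implication : Λ (τ t₂) (τ t₂') ⊆Λ Λ (τ t₁) (τ t₁') →
                          (A : LinearQuasigroup) → Satisfies A t₁ t₁' → Satisfies A t₂ t₂'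
  inclusion⇒implication Λ₂⊆Λ₁ A sat₁ = from (satisfies⇔Λ⊆Balanced A t₂ t₂')
    λ v v∈Λ₂ → to (satisfies⇔Λ⊆Balanced A t₁ t₁') sat₁ v (Λ₂⊆Λ₁ v v∈Λ₂)
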